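{- For every prime $p$ there is a bipartite graph $H$ with a distinguished vertex $h$ such that (i) the number of independent sets of $H$ is congruent to $0$ modulo $p$, and (ii) the number of independent sets of $H\setminus\{h\}$ is not congruent to $0$ modulo $p$. Moreover, for $p>2$, the complete bipartite graph $K_{p-2,p-2}$, with any vertex as distinguished vertex, is such an $H$.
   Context: Independent sets include the empty set. -}

module Defs where

open import Data.Bool using (Bool; true; false; _xor_)
open import Data.Nat using (ℕ; zero; suc; _+_; _<?_)
open import Data.Fin using (Fin; toℕ; punchIn)
open import Data.Fin.Properties using (all?)
open import Data.Fin.Subset using (Subset; _∈_; inside; outside)
open import Data.Fin.Subset.Properties using (_∈?_)
open import Data.List using (List; []; _∷_; map; _++_; length; filter)
open import Data.Vec using ([]; _∷_)
open import Data.Product using (∃)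
open import Relation.Binary.PropositionalEquality using (_≡_; _≢_)
open import Relation.Nullary using (Dec; yes; no)
open import Relation.Nullary.Decidable using (isYes)
open import Data.Bool.Properties using () renaming (_≟_ to _≟ᵇ_)

record Graph (n : ℕ) : Set where
  field
    adj   : Fin n → Fin n → Bool
    sym   : ∀ i j → adj i j ≡ adj j i
    irrefl : ∀ i → adj i i ≡ false
open Graph public

Bipartite : ∀ {n} → Graph n → Set
Bipartite {n} G = ∃ λ (c : Fin n → Bool) → ∀ i j → adj G i j ≡ true → c i ≢ c j

IsIndependent : ∀ {n} → Graph n → Subset n → Set
IsIndependent G S = ∀ i j → i ∈ S → j ∈ S → adj G i j ≡ false

private
  impl? : ∀ {A B : Set} → Dec A → Dec B → Dec (A → B)
  impl? (yes a) (yes b) = yes (λ _ → b)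
  impl? (yes a) (no ¬b) = no (λ f → ¬b (f a))
  impl? (no ¬a) _ = yes (λ a → Data.Empty.⊥-elim (¬a a))
    where import Data.Empty

isIndependent? : ∀ {n} (G : Graph n) (S : Subset n) → Dec (IsIndependent G S)
isIndependent? G S =
  all? λ i → all? λ j → impl? (i ∈? S) (impl? (j ∈? S) (adj G i j ≟ᵇ false))

allSubsets : ∀ n → List (Subset n)
allSubsets zero = [] ∷ []
allSubsets (suc n) = map (inside ∷_) (allSubsets n) ++ map (outside ∷_) (allSubsets n)

numIndependentSets : ∀ {n} → Graph n → ℕ
numIndependentSets {n} G = length (filter (isIndependent? G) (allSubsets n))

deleteVertex : ∀ {n} → Graph (suc n) → Fin (suc n) → Graph n
deleteVertex G h = record
  { adj = λ i j → adj G (punchIn h i) (punchIn h j)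
  ; sym = λ i j → sym G (punchIn h i) (punchIn h j)
  ; irrefl = λ i → irrefl G (punchIn h i)
  }

-- Complete bipartite graph K_{a,b} on Fin (a + b): vertices with index < a form one side.
private
  side : ∀ {n} (a : ℕ) → Fin n → Bool
  side a i = isYes (toℕ i <? a)

  xor-comm : ∀ x y → x xor y ≡ y xor x
  xor-comm true true = Relation.Binary.PropositionalEquality.refl
  xor-comm true false = Relation.Binary.PropositionalEquality.refl
  xor-comm false true = Relation.Binary.PropositionalEquality.refl
  xor-comm false false = Relation.Binary.PropositionalEquality.refl

  xor-self : ∀ x → x xor x ≡ false
  xor-self true = Relation.Binary.PropositionalEquality.refl
  xor-self false = Relation.Binary.PropositionalEquality.refl

completeBipartite : (a b : ℕ) → Graph (a + b)
completeBipartite a b = record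
  { adj = λ i j → side a i xor side a j
  ; sym = λ i j → xor-comm (side a i) (side a j)
  ; irrefl = λ i → xor-self (side a i)
  }

-- An independent set of a complete bipartite graph cannot meet both parts, so K_{a,b} has
-- 2^a + 2^b - 1 independent sets (the empty set lies on both sides). For a prime p >= 3,
-- K_{p-2,p-2} therefore has N = 2^(p-1) - 1 independent sets, a multiple of p by Fermat's little
-- theorem, while deleting any vertex leaves K_{p-3,p-2} with N' = 3 * 2^(p-3) - 1. From
-- 4 (N' + 1) = 3 (N + 1) we get 3 N = 4 N' + 1, so p cannot also divide N'. For p = 2 a single
-- vertex works. Fermat's theorem for the base 2 comes from expanding 2^p = (1 + 1)^p: all binomial
-- coefficients C(p,k) with 0 < k < p are multiples of p, because p divides p! but not k! (p - k)!.

module Submission where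

open import Defs
  using (Graph; adj; Bipartite; IsIndependent; isIndependent?; allSubsets;
         numIndependentSets; deleteVertex; completeBipartite)
open import Data.Bool using (true; false; _xor_)
open import Data.Bool.Properties using (xor-same)
open import Data.Nat
open import Data.Nat.Properties
open import Data.Nat.Combinatorics using (_C_; nCn≡1; nCk≡n!/k![n-k]!; k![n∸k]!∣n!)
open import Data.Nat.Divisibility
open import Data.Nat.DivMod using (_/_; m/n*n≡m)
open import Data.Nat.Primality using (Prime; euclidsLemma; ¬prime[0]; ¬prime[1])
open import Data.Fin using (Fin; zero; suc; toℕ; punchIn; fromℕ; inject₁)
open import Data.Fin.Properties using (toℕ<n; toℕ-inject₁; toℕ-fromℕ)
open import Data.Fin.Subset using (Subset; inside; outside; _∈_; _∉_; _⊆_; ∁; ∣_∣; ⊥)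
open import Data.Fin.Subset.Properties
  using (_∈?_; _⊆?_; nonempty?; drop-∷-⊆; in⊆in; out⊆; ⊥⊆; ⊆-trans; ∣⊥∣≡0; ∣∁p∣≡n∸∣p∣;
         drop-not-there; x∈p⇒x∉∁p; x∈∁p⇒x∉p; x∉p⇒x∈∁p)
open import Data.List using ([]; _∷_; map; _++_; length; filter)
open import Data.List.Properties using (filter-++; length-++; filter-≐; filter-none)
open import Data.List.Relation.Unary.All using (universal)
open import Data.Product using (_×_; _,_; ∃)
open import Data.Sum using (_⊎_; inj₁; inj₂; [_,_]′)
open import Data.Vec using (Vec; []; _∷_; lookup; tabulate; removeAt; here; there)
open import Data.Vec.Properties using (lookup⇒[]=; []=⇒lookup; lookup∘tabulate)
open import Function using (id; _∘_; case_of_)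
open import Relation.Nullary using (¬_; Dec; does; yes; no; contradiction)
open import Relation.Nullary.Decidable using (isYes; isYes≗does)
open import Relation.Unary using (Pred; Decidable; _≐_)
open import Relation.Unary.Properties using (_∪?_; _∩?_)
open import Relation.Binary.PropositionalEquality
open import Algebra.Definitions.RawSemiring +-*-rawSemiring using () renaming (_×_ to _×ₛ_; _^_ to _^ₛ_)
open import Algebra.Properties.Monoid.Sum +-0-monoid using (sum; sum-cong-≗; sum-init-last)
import Algebra.Properties.CommutativeSemiring.Binomial +-*-commutativeSemiring as Binomial

-- Fermat's little theorem for the base 2

prime∤1 : ∀ {p} → Prime p → p ∤ 1
prime∤1 pr p∣1 = ¬prime[1] (subst Prime (∣1⇒≡1 p∣1) pr)

prime∤! : ∀ {p m} → Prime p → m < p → p ∤ m !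
prime∤! {m = zero}  pr _   = prime∤1 pr
prime∤! {m = suc m} pr m<p p∣m! with euclidsLemma (suc m) (m !) pr p∣m!
... | inj₁ p∣1+m = <⇒≱ m<p (∣⇒≤ p∣1+m)
... | inj₂ p∣m!  = prime∤! pr (<-trans (n<1+n m) m<p) p∣m!

n!≡nCk*k!*[n∸k]! : ∀ {n k} → k ≤ n → n ! ≡ (n C k) * (k ! * (n ∸ k) !)
n!≡nCk*k!*[n∸k]! {n} {k} k≤n = sym (begin
  (n C k) * (k ! * (n ∸ k) !)                  ≡⟨ cong (_* (k ! * (n ∸ k) !)) (nCk≡n!/k![n-k]! k≤n) ⟩
  n ! / (k ! * (n ∸ k) !) * (k ! * (n ∸ k) !)  ≡⟨ m/n*n≡m (k![n∸k]!∣n! k≤n) ⟩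
  n !                                          ∎)
  where
  open ≡-Reasoning
  instance _ = k !* (n ∸ k) !≢0

prime∣pCk : ∀ {p k} → Prime p → 0 < k → k < p → p ∣ p C k
prime∣pCk {suc p} {k} pr 0<k k<p
  with euclidsLemma (suc p C k) (k ! * (suc p ∸ k) !) pr
         (subst (suc p ∣_) (n!≡nCk*k!*[n∸k]! (<⇒≤ k<p)) (m∣m*n (p !)))
... | inj₁ p∣pCk = p∣pCk
... | inj₂ p∣k![p∸k]! with euclidsLemma (k !) ((suc p ∸ k) !) pr p∣k![p∸k]!
...   | inj₁ p∣k!     = contradiction p∣k! (prime∤! pr k<p)
...   | inj₂ p∣[p∸k]! = contradiction p∣[p∸k]! (prime∤! pr (∸-monoʳ-< 0<k (<⇒≤ k<p)))

-- The library's binomial theorem is stated with the generic semiring power and multiple, which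
-- agree with ℕ's _^_ and _*_ only propositionally.
^ₛ≡^ : ∀ x n → x ^ₛ n ≡ x ^ n
^ₛ≡^ x zero    = refl
^ₛ≡^ x (suc n) = cong (x *_) (^ₛ≡^ x n)

×ₛ≡* : ∀ m x → m ×ₛ x ≡ m * x
×ₛ≡* zero    x = refl
×ₛ≡* (suc m) x = cong (x +_) (×ₛ≡* m x)

2^n≡∑nCk : ∀ n → 2 ^ n ≡ sum (λ (k : Fin (suc n)) → n C toℕ k)
2^n≡∑nCk n = begin
  2 ^ n                            ≡⟨ ^ₛ≡^ 2 n ⟨
  (1 + 1) ^ₛ n                     ≡⟨ Binomial.theorem n 1 1 ⟩
  Binomial.binomialExpansion 1 1 n ≡⟨ sum-cong-≗ binomialTerm≡nCk ⟩
  sum (λ (k : Fin (suc n)) → n C toℕ k) ∎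
  where
  open ≡-Reasoning
  1^ₛ≡1 : ∀ j → 1 ^ₛ j ≡ 1
  1^ₛ≡1 j = trans (^ₛ≡^ 1 j) (^-zeroˡ j)
  binomialTerm≡nCk : ∀ k → Binomial.binomialTerm 1 1 n k ≡ n C toℕ k
  binomialTerm≡nCk k = begin
    (n C toℕ k) ×ₛ (1 ^ₛ toℕ k * 1 ^ₛ (n ∸ toℕ k))
      ≡⟨ ×ₛ≡* (n C toℕ k) _ ⟩
    (n C toℕ k) * (1 ^ₛ toℕ k * 1 ^ₛ (n ∸ toℕ k))
      ≡⟨ cong ((n C toℕ k) *_) (cong₂ _*_ (1^ₛ≡1 (toℕ k)) (1^ₛ≡1 (n ∸ toℕ k))) ⟩
    (n C toℕ k) * 1
      ≡⟨ *-identityʳ _ ⟩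
    n C toℕ k ∎

∣-sum : ∀ {d n} (f : Fin n → ℕ) → (∀ i → d ∣ f i) → d ∣ sum f
∣-sum {n = zero}  f _   = _ ∣0
∣-sum {n = suc n} f d∣f = ∣m∣n⇒∣m+n (d∣f zero) (∣-sum (f ∘ suc) (d∣f ∘ suc))

prime⇒p∣2^p∸2 : ∀ {p} → Prime p → p ∣ 2 ^ p ∸ 2
prime⇒p∣2^p∸2 {0}           pr = contradiction pr ¬prime[0]
prime⇒p∣2^p∸2 {1}           pr = contradiction pr ¬prime[1]
prime⇒p∣2^p∸2 {p@(suc (suc q))} pr = subst (p ∣_) (sym 2^p∸2≡∑middle) (∣-sum middle p∣middle)
  where
  upper : Fin p → ℕ
  upper i = p C suc (toℕ i)
  middle : Fin (suc q) → ℕ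
  middle i = upper (inject₁ i)
  p∣middle : ∀ i → p ∣ middle i
  p∣middle i = prime∣pCk pr z<s (s<s (subst (_< suc q) (sym (toℕ-inject₁ i)) (toℕ<n i)))
  2^p∸2≡∑middle : 2 ^ p ∸ 2 ≡ sum middle
  2^p∸2≡∑middle = begin
    2 ^ p ∸ 2
      ≡⟨ cong (_∸ 2) (2^n≡∑nCk p) ⟩
    1 + sum upper ∸ 2
      ≡⟨ cong (λ s → 1 + s ∸ 2) (sum-init-last upper) ⟩
    1 + (sum middle + p C suc (toℕ (fromℕ (suc q)))) ∸ 2
      ≡⟨ cong (λ j → 1 + (sum middle + p C suc j) ∸ 2) (toℕ-fromℕ (suc q)) ⟩
    1 + (sum middle + p C p) ∸ 2
      ≡⟨ cong (λ c → 1 + (sum middle + c) ∸ 2) (nCn≡1 p) ⟩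
    sum middle + 1 ∸ 1
      ≡⟨ m+n∸n≡m (sum middle) 1 ⟩
    sum middle ∎
    where open ≡-Reasoning

oddPrime∣2^[p-1]∸1 : ∀ {k} → Prime (3 + k) → 3 + k ∣ 2 ^ (2 + k) ∸ 1
oddPrime∣2^[p-1]∸1 {k} pr =
  [ (λ p∣2 → contradiction (∣⇒≤ p∣2) λ { (s≤s (s≤s ())) }) , id ]′
  (euclidsLemma 2 (2 ^ (2 + k) ∸ 1) pr p∣2*[2^[p-1]∸1])
  where
  p∣2*[2^[p-1]∸1] : 3 + k ∣ 2 * (2 ^ (2 + k) ∸ 1)
  p∣2*[2^[p-1]∸1] = subst (3 + k ∣_) (sym (*-distribˡ-∸ 2 (2 ^ (2 + k)) 1)) (prime⇒p∣2^p∸2 pr)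

-- Counting subsets

module _ {a p} {A : Set a} {P : Pred A p} (P? : Decidable P) where

  length-filter-map : ∀ {b} {B : Set b} (f : B → A) xs →
                      length (filter P? (map f xs)) ≡ length (filter (P? ∘ f) xs)
  length-filter-map f [] = refl
  length-filter-map f (x ∷ xs) with does (P? (f x))
  ... | true  = cong suc (length-filter-map f xs)
  ... | false = length-filter-map f xs

  length-filter-∪+∩ : ∀ {q} {Q : Pred A q} (Q? : Decidable Q) xs →
    length (filter (P? ∪? Q?) xs) + length (filter (P? ∩? Q?) xs)
      ≡ length (filter P? xs) + length (filter Q? xs)
  length-filter-∪+∩ Q? [] = refl
  length-filter-∪+∩ Q? (x ∷ xs) with ih ← length-filter-∪+∩ Q? xs | does (P? x) | does (Q? x)
  ... | true  | true  = cong suc (trans (+-suc _ _) (trans (cong suc ih) (sym (+-suc _ _))))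
  ... | true  | false = cong suc ih
  ... | false | true  = trans (cong suc ih) (sym (+-suc _ _))
  ... | false | false = ih

countSubsets : ∀ {n p} {P : Pred (Subset n) p} → Decidable P → ℕ
countSubsets {n} P? = length (filter P? (allSubsets n))

module _ {n p} {P : Pred (Subset (suc n)) p} (P? : Decidable P) where

  countSubsets-∷ : countSubsets P? ≡ countSubsets (P? ∘ (inside ∷_)) + countSubsets (P? ∘ (outside ∷_))
  countSubsets-∷ = begin
    length (filter P? (map (inside ∷_) Ss ++ map (outside ∷_) Ss))
      ≡⟨ cong length (filter-++ P? (map (inside ∷_) Ss) _) ⟩
    length (filter P? (map (inside ∷_) Ss) ++ filter P? (map (outside ∷_) Ss))
      ≡⟨ length-++ (filter P? (map (inside ∷_) Ss)) ⟩
    length (filter P? (map (inside ∷_) Ss)) + length (filter P? (map (outside ∷_) Ss))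
      ≡⟨ cong₂ _+_ (length-filter-map P? (inside ∷_) Ss) (length-filter-map P? (outside ∷_) Ss) ⟩
    countSubsets (P? ∘ (inside ∷_)) + countSubsets (P? ∘ (outside ∷_)) ∎
    where
    open ≡-Reasoning
    Ss = allSubsets n

countSubsets-≐ : ∀ {n p q} {P : Pred (Subset n) p} {Q : Pred (Subset n) q}
                 (P? : Decidable P) (Q? : Decidable Q) → P ≐ Q → countSubsets P? ≡ countSubsets Q?
countSubsets-≐ {n} P? Q? P≐Q = cong length (filter-≐ P? Q? P≐Q (allSubsets n))

countSubsets-⊆ : ∀ {n} (A : Subset n) → countSubsets (_⊆? A) ≡ 2 ^ ∣ A ∣
countSubsets-⊆ [] = refl
countSubsets-⊆ (inside ∷ A) = begin
  countSubsets (_⊆? inside ∷ A)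
    ≡⟨ countSubsets-∷ (_⊆? inside ∷ A) ⟩
  countSubsets ((_⊆? inside ∷ A) ∘ (inside ∷_)) + countSubsets ((_⊆? inside ∷ A) ∘ (outside ∷_))
    ≡⟨ cong₂ _+_ (countSubsets-≐ _ (_⊆? A) (drop-∷-⊆ , in⊆in))
                 (countSubsets-≐ _ (_⊆? A) (drop-∷-⊆ , out⊆)) ⟩
  countSubsets (_⊆? A) + countSubsets (_⊆? A)
    ≡⟨ cong₂ _+_ (countSubsets-⊆ A) (trans (countSubsets-⊆ A) (sym (+-identityʳ _))) ⟩
  2 ^ suc ∣ A ∣ ∎
  where open ≡-Reasoning
countSubsets-⊆ {suc n} (outside ∷ A) = begin
  countSubsets (_⊆? outside ∷ A)
    ≡⟨ countSubsets-∷ (_⊆? outside ∷ A) ⟩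
  countSubsets ((_⊆? outside ∷ A) ∘ (inside ∷_)) + countSubsets ((_⊆? outside ∷ A) ∘ (outside ∷_))
    ≡⟨ cong₂ _+_ (cong length (filter-none _ (universal (λ _ S⊆ → case S⊆ here of λ ()) (allSubsets n))))
                 (countSubsets-≐ _ (_⊆? A) (drop-∷-⊆ , out⊆)) ⟩
  countSubsets (_⊆? A)
    ≡⟨ countSubsets-⊆ A ⟩
  2 ^ ∣ A ∣ ∎
  where open ≡-Reasoning

countSubsets-⊆∩⊆∁ : ∀ {n} (A : Subset n) → countSubsets ((_⊆? A) ∩? (_⊆? ∁ A)) ≡ 1
countSubsets-⊆∩⊆∁ {n} A = begin
  countSubsets ((_⊆? A) ∩? (_⊆? ∁ A))
    ≡⟨ countSubsets-≐ _ (_⊆? ⊥ {n}) (⊆⊥ , λ S⊆⊥ → ⊆-trans S⊆⊥ ⊥⊆ , ⊆-trans S⊆⊥ ⊥⊆) ⟩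
  countSubsets (_⊆? ⊥ {n})
    ≡⟨ countSubsets-⊆ (⊥ {n}) ⟩
  2 ^ ∣ ⊥ {n} ∣
    ≡⟨ cong (2 ^_) (∣⊥∣≡0 n) ⟩
  1 ∎
  where
  open ≡-Reasoning
  ⊆⊥ : ∀ {S} → S ⊆ A × S ⊆ ∁ A → S ⊆ ⊥
  ⊆⊥ (S⊆A , S⊆∁A) x∈S = contradiction (S⊆∁A x∈S) (x∈p⇒x∉∁p (S⊆A x∈S))

-- Complete bipartite graphs

record IsCompleteBipartite {n} (G : Graph n) (A : Subset n) : Set where
  constructor adj≡xor⇒isCompleteBipartite
  field
    adj≡xor : ∀ i j → adj G i j ≡ lookup A i xor lookup A j

open IsCompleteBipartite

xor≡false⇒≡ : ∀ x y → x xor y ≡ false → x ≡ y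
xor≡false⇒≡ false false _ = refl
xor≡false⇒≡ true  true  _ = refl

∉⇒lookup≡outside : ∀ {n} {i : Fin n} {A : Subset n} → i ∉ A → lookup A i ≡ outside
∉⇒lookup≡outside {i = i} {A} i∉A with lookup A i in eq
... | inside  = contradiction (lookup⇒[]= i A eq) i∉A
... | outside = refl

lookup≡outside⇒∉ : ∀ {n} {i : Fin n} {A : Subset n} → lookup A i ≡ outside → i ∉ A
lookup≡outside⇒∉ eq i∈A = case trans (sym ([]=⇒lookup i∈A)) eq of λ ()

module _ {n} {G : Graph n} {A : Subset n} (isK : IsCompleteBipartite G A) {S : Subset n} where

  SameSide : Set
  SameSide = ∀ {i j} → i ∈ S → j ∈ S → lookup A i ≡ lookup A j

  independent⇒sameSide : IsIndependent G S → SameSide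
  independent⇒sameSide ind {i} {j} i∈S j∈S = xor≡false⇒≡ _ _ (trans (sym (adj≡xor isK i j)) (ind i j i∈S j∈S))

  sameSide⇒independent : SameSide → IsIndependent G S
  sameSide⇒independent same i j i∈S j∈S =
    trans (adj≡xor isK i j) (trans (cong (_xor lookup A j) (same i∈S j∈S)) (xor-same (lookup A j)))

  sameSide⇒⊆part : SameSide → S ⊆ A ⊎ S ⊆ ∁ A
  sameSide⇒⊆part same with nonempty? S
  ... | no S-empty = inj₁ (λ i∈S → contradiction (_ , i∈S) S-empty)
  ... | yes (i , i∈S) with lookup A i in Ai
  ...   | inside  = inj₁ (λ {j} j∈S → lookup⇒[]= j A (trans (sym (same i∈S j∈S)) Ai))
  ...   | outside = inj₂ (λ j∈S → x∉p⇒x∈∁p (lookup≡outside⇒∉ (trans (sym (same i∈S j∈S)) Ai)))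

  ⊆part⇒sameSide : S ⊆ A ⊎ S ⊆ ∁ A → SameSide
  ⊆part⇒sameSide (inj₁ S⊆A)  i∈S j∈S = trans ([]=⇒lookup (S⊆A i∈S)) (sym ([]=⇒lookup (S⊆A j∈S)))
  ⊆part⇒sameSide (inj₂ S⊆∁A) i∈S j∈S = trans (outside-of i∈S) (sym (outside-of j∈S))
    where
    outside-of : ∀ {i} → i ∈ S → lookup A i ≡ outside
    outside-of = ∉⇒lookup≡outside ∘ x∈∁p⇒x∉p ∘ S⊆∁A

  independent⇒⊆part : IsIndependent G S → S ⊆ A ⊎ S ⊆ ∁ A
  independent⇒⊆part = sameSide⇒⊆part ∘ independent⇒sameSide

  ⊆part⇒independent : S ⊆ A ⊎ S ⊆ ∁ A → IsIndependent G S
  ⊆part⇒independent = sameSide⇒independent ∘ ⊆part⇒sameSide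

numIndependentSets-completeBipartite : ∀ {n} {G : Graph n} {A : Subset n} → IsCompleteBipartite G A →
  numIndependentSets G + 1 ≡ 2 ^ ∣ A ∣ + 2 ^ ∣ ∁ A ∣
numIndependentSets-completeBipartite {n} {G} {A} isK = begin
  numIndependentSets G + 1
    ≡⟨ cong₂ _+_ (countSubsets-≐ (isIndependent? G) (⊆A? ∪? ⊆∁A?)
                                 (independent⇒⊆part isK , ⊆part⇒independent isK))
                 (sym (countSubsets-⊆∩⊆∁ A)) ⟩
  countSubsets (⊆A? ∪? ⊆∁A?) + countSubsets (⊆A? ∩? ⊆∁A?)
    ≡⟨ length-filter-∪+∩ ⊆A? ⊆∁A? (allSubsets n) ⟩
  countSubsets ⊆A? + countSubsets ⊆∁A?
    ≡⟨ cong₂ _+_ (countSubsets-⊆ A) (countSubsets-⊆ (∁ A)) ⟩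
  2 ^ ∣ A ∣ + 2 ^ ∣ ∁ A ∣ ∎
  where
  open ≡-Reasoning
  ⊆A? = _⊆? A
  ⊆∁A? = _⊆? ∁ A

-- With does rather than the isYes of completeBipartite, membership computes on open indices.
leftPart : ∀ a {b} → Subset (a + b)
leftPart a = tabulate (λ i → does (toℕ i <? a))

completeBipartite-isCompleteBipartite : ∀ a b → IsCompleteBipartite (completeBipartite a b) (leftPart a)
completeBipartite-isCompleteBipartite a b =
  adj≡xor⇒isCompleteBipartite λ i j → cong₂ _xor_ (side i) (side j)
  where
  side : ∀ (i : Fin (a + b)) → isYes (toℕ i <? a) ≡ lookup (leftPart a) i
  side i = trans (isYes≗does (toℕ i <? a)) (sym (lookup∘tabulate _ i))

∣leftPart∣ : ∀ a {b} → ∣ leftPart a {b} ∣ ≡ a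
∣leftPart∣ zero    {zero}  = refl
∣leftPart∣ zero    {suc b} = ∣leftPart∣ zero {b}
∣leftPart∣ (suc a)         = cong suc (∣leftPart∣ a)

lookup-removeAt : ∀ {a} {X : Set a} {n} (xs : Vec X (suc n)) i j →
                  lookup (removeAt xs i) j ≡ lookup xs (punchIn i j)
lookup-removeAt (x ∷ xs)     zero    j       = refl
lookup-removeAt (x ∷ y ∷ xs) (suc i) zero    = refl
lookup-removeAt (x ∷ y ∷ xs) (suc i) (suc j) = lookup-removeAt (y ∷ xs) i j

∣removeAt∣-∈ : ∀ {n} (A : Subset (suc n)) {h} → h ∈ A → ∣ A ∣ ≡ suc ∣ removeAt A h ∣
∣removeAt∣-∈ (inside  ∷ A)         here        = refl
∣removeAt∣-∈ (inside  ∷ A@(_ ∷ _)) (there h∈A) = cong suc (∣removeAt∣-∈ A h∈A)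
∣removeAt∣-∈ (outside ∷ A@(_ ∷ _)) (there h∈A) = ∣removeAt∣-∈ A h∈A

∣removeAt∣-∉ : ∀ {n} (A : Subset (suc n)) {h} → h ∉ A → ∣ A ∣ ≡ ∣ removeAt A h ∣
∣removeAt∣-∉ (inside  ∷ A)         {zero}  h∉A = contradiction here h∉A
∣removeAt∣-∉ (outside ∷ A)         {zero}  h∉A = refl
∣removeAt∣-∉ (inside  ∷ A@(_ ∷ _)) {suc h} h∉A = cong suc (∣removeAt∣-∉ A (drop-not-there h∉A))
∣removeAt∣-∉ (outside ∷ A@(_ ∷ _)) {suc h} h∉A = ∣removeAt∣-∉ A (drop-not-there h∉A)

deleteVertex-isCompleteBipartite : ∀ {n} {G : Graph (suc n)} {A} → IsCompleteBipartite G A →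
  ∀ h → IsCompleteBipartite (deleteVertex G h) (removeAt A h)
deleteVertex-isCompleteBipartite {A = A} isK h = adj≡xor⇒isCompleteBipartite λ i j →
  trans (adj≡xor isK _ _) (sym (cong₂ _xor_ (lookup-removeAt A h i) (lookup-removeAt A h j)))

isCompleteBipartite⇒bipartite : ∀ {n} {G : Graph n} {A} → IsCompleteBipartite G A → Bipartite G
isCompleteBipartite⇒bipartite {A = A} isK = lookup A , λ i j adjacent same →
  case trans (sym adjacent) (trans (adj≡xor isK i j) (trans (cong (_xor lookup A j) same) (xor-same (lookup A j))))
  of λ ()

numIndependentSets-K[a,b] : ∀ a b → numIndependentSets (completeBipartite a b) + 1 ≡ 2 ^ a + 2 ^ b
numIndependentSets-K[a,b] a b = begin
  numIndependentSets (completeBipartite a b) + 1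
    ≡⟨ numIndependentSets-completeBipartite (completeBipartite-isCompleteBipartite a b) ⟩
  2 ^ ∣ leftPart a ∣ + 2 ^ ∣ ∁ (leftPart a) ∣
    ≡⟨ cong₂ _+_ (cong (2 ^_) (∣leftPart∣ a)) (cong (2 ^_) ∣rightPart∣) ⟩
  2 ^ a + 2 ^ b ∎
  where
  open ≡-Reasoning
  ∣rightPart∣ : ∣ ∁ (leftPart a {b}) ∣ ≡ b
  ∣rightPart∣ = trans (∣∁p∣≡n∸∣p∣ (leftPart a)) (trans (cong (a + b ∸_) (∣leftPart∣ a)) (m+n∸m≡n a b))

numIndependentSets-K[1+k,1+k]-deleteVertex : ∀ k h →
  numIndependentSets (deleteVertex (completeBipartite (suc k) (suc k)) h) + 1 ≡ 2 ^ k + 2 ^ suc k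
numIndependentSets-K[1+k,1+k]-deleteVertex k h =
  trans (numIndependentSets-completeBipartite
          (deleteVertex-isCompleteBipartite (completeBipartite-isCompleteBipartite (suc k) (suc k)) h))
        (parts (h ∈? A))
  where
  A = leftPart (suc k) {suc k}
  A′ = removeAt A h
  ∣∁A′∣≡ : ∀ {x} → ∣ A′ ∣ ≡ x → ∣ ∁ A′ ∣ ≡ k + suc k ∸ x
  ∣∁A′∣≡ ∣A′∣≡x = trans (∣∁p∣≡n∸∣p∣ A′) (cong (k + suc k ∸_) ∣A′∣≡x)
  parts : Dec (h ∈ A) → 2 ^ ∣ A′ ∣ + 2 ^ ∣ ∁ A′ ∣ ≡ 2 ^ k + 2 ^ suc k
  parts (yes h∈A) = cong₂ (λ x y → 2 ^ x + 2 ^ y) ∣A′∣≡k (trans (∣∁A′∣≡ ∣A′∣≡k) (m+n∸m≡n k (suc k)))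
    where
    ∣A′∣≡k : ∣ A′ ∣ ≡ k
    ∣A′∣≡k = suc-injective (trans (sym (∣removeAt∣-∈ A h∈A)) (∣leftPart∣ (suc k)))
  parts (no h∉A) = trans (cong₂ (λ x y → 2 ^ x + 2 ^ y) ∣A′∣≡1+k (trans (∣∁A′∣≡ ∣A′∣≡1+k) (m+n∸n≡m k (suc k))))
                         (+-comm (2 ^ suc k) (2 ^ k))
    where
    ∣A′∣≡1+k : ∣ A′ ∣ ≡ suc k
    ∣A′∣≡1+k = trans (sym (∣removeAt∣-∉ A h∉A)) (∣leftPart∣ (suc k))

∣4t∸1∧∣3t∸1⇒∣1 : ∀ {d N N′} t → N + 1 ≡ 4 * t → N′ + 1 ≡ 3 * t → d ∣ N → d ∣ N′ → d ∣ 1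
∣4t∸1∧∣3t∸1⇒∣1 {d} {N} {N′} t N+1≡4t N′+1≡3t d∣N d∣N′ =
  ∣m+n∣m⇒∣n (subst (d ∣_) 3N≡4N′+1 (∣n⇒∣m*n 3 d∣N)) (∣n⇒∣m*n 4 d∣N′)
  where
  open ≡-Reasoning
  3N≡4N′+1 : 3 * N ≡ 4 * N′ + 1
  3N≡4N′+1 = +-cancelʳ-≡ 3 _ _ (begin
    3 * N + 3        ≡⟨ *-distribˡ-+ 3 N 1 ⟨
    3 * (N + 1)      ≡⟨ cong (3 *_) N+1≡4t ⟩
    3 * (4 * t)      ≡⟨ *-assoc 3 4 t ⟨
    12 * t           ≡⟨ *-assoc 4 3 t ⟩
    4 * (3 * t)      ≡⟨ cong (4 *_) N′+1≡3t ⟨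
    4 * (N′ + 1)     ≡⟨ *-distribˡ-+ 4 N′ 1 ⟩
    4 * N′ + 4       ≡⟨ +-assoc (4 * N′) 1 3 ⟨
    4 * N′ + 1 + 3   ∎)

K[p-2,p-2]-witness : ∀ k → Prime (3 + k) → ∀ (h : Fin (suc k + suc k)) →
  Bipartite (completeBipartite (suc k) (suc k))
  × (3 + k) ∣ numIndependentSets (completeBipartite (suc k) (suc k))
  × ¬ ((3 + k) ∣ numIndependentSets (deleteVertex (completeBipartite (suc k) (suc k)) h))
K[p-2,p-2]-witness k pr h =
  isCompleteBipartite⇒bipartite (completeBipartite-isCompleteBipartite (suc k) (suc k)) , p∣N , p∤N′
  where
  N = numIndependentSets (completeBipartite (suc k) (suc k))
  N+1≡2^[2+k] : N + 1 ≡ 2 ^ (2 + k)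
  N+1≡2^[2+k] = trans (numIndependentSets-K[a,b] (suc k) (suc k)) (cong (2 ^ suc k +_) (sym (+-identityʳ _)))
  p∣N : 3 + k ∣ N
  p∣N = subst (3 + k ∣_) (trans (cong (_∸ 1) (sym N+1≡2^[2+k])) (m+n∸n≡m N 1)) (oddPrime∣2^[p-1]∸1 pr)
  p∤N′ : 3 + k ∤ numIndependentSets (deleteVertex (completeBipartite (suc k) (suc k)) h)
  -- 2 ^ k + 2 ^ suc k and 3 * 2 ^ k are the same number by computation.
  p∤N′ p∣N′ = prime∤1 pr (∣4t∸1∧∣3t∸1⇒∣1 (2 ^ k) (trans N+1≡2^[2+k] (sym (*-assoc 2 2 (2 ^ k))))
                            (numIndependentSets-K[1+k,1+k]-deleteVertex k h) p∣N p∣N′)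

everyPrime-witness : ∀ p → Prime p →
  ∃ λ n → ∃ λ (H : Graph (suc n)) → ∃ λ (h : Fin (suc n)) →
    Bipartite H × p ∣ numIndependentSets H × ¬ (p ∣ numIndependentSets (deleteVertex H h))
everyPrime-witness 0 pr = contradiction pr ¬prime[0]
everyPrime-witness 1 pr = contradiction pr ¬prime[1]
everyPrime-witness 2 pr =
  -- a single vertex: independent sets ∅ and the vertex itself, and only ∅ once it is deleted
  0 , completeBipartite 1 0 , zero ,
  isCompleteBipartite⇒bipartite (completeBipartite-isCompleteBipartite 1 0) , ∣-refl , prime∤1 pr
everyPrime-witness (suc (suc (suc k))) pr =
  k + suc k , completeBipartite (suc k) (suc k) , zero , K[p-2,p-2]-witness k pr zero

mainTheorem8 :
    (∀ (p : ℕ) → Prime p →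
      ∃ λ (n : ℕ) → ∃ λ (H : Graph (suc n)) → ∃ λ (h : Fin (suc n)) →
        Bipartite H
        × p ∣ numIndependentSets H
        × ¬ (p ∣ numIndependentSets (deleteVertex H h)))
    × (∀ (k : ℕ) → Prime (3 + k) → ∀ (h : Fin (suc k + suc k)) →
        Bipartite (completeBipartite (suc k) (suc k))
        × (3 + k) ∣ numIndependentSets (completeBipartite (suc k) (suc k))
        × ¬ ((3 + k) ∣ numIndependentSets (deleteVertex (completeBipartite (suc k) (suc k)) h)))
mainTheorem8 = everyPrime-witness , K[p-2,p-2]-witness
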